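{- Let $S_n=\sum_{k=0}^n\binom{n}{k}^2\binom{2k}{k}(2k+1)$ for $n\geq 0$. Then $\{S_n\}_{n\geq 0}$ is strictly log-convex, i.e. $S_n^2<S_{n+1}S_{n-1}$ for all $n\geq 1$. -}

module Defs where

open import Data.Nat using (ℕ; zero; suc; _+_; _*_; _^_)
open import Data.Nat.Combinatorics using (_C_)
open import Data.List using (map; upTo)
open import Data.Nat.ListAction using (sum)

term : ℕ → ℕ → ℕ
term n k = ((n C k) ^ 2) * ((2 * k) C k) * (2 * k + 1)

S : ℕ → ℕ
S n = sum (map (term n) (upTo (suc n)))

-- Write t(n,k) = C(n,k)² C(2k,k) and F n = Σₖ t(n,k), so that S n = Σₖ (2k+1) t(n,k).
-- Telescoping in k (Zeilberger-style certificates, built from Pascal's rule and the absorption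
-- identity) gives 3 Σₖ k t(n,k) = 2n F n, hence 3 S n = (4n+3) F n, and the recurrence
-- (n+2)² F(n+2) + 9(n+1)² F n = (10n²+30n+23) F(n+1). By induction along the recurrence the
-- ratio F(n+1)/F n stays in [3, 9(4n+1)/(4n+5)] for n ≥ 1. After eliminating F(n+2), the
-- inequality (4n+7)² F(n+1)² < (4n+3)(4n+11) F(n+2) F n says that a quadratic in that ratio with
-- positive leading coefficient is negative; expressing F n and F(n+1) through the slacks
-- p = F(n+1) − 3 F n and q = 9(4n+1) F n − (4n+5) F(n+1) turns it into the positivity of a
-- binary quadratic form in p, q with positive coefficients.

module Submission where

open import Data.List using ([]; _∷_; [_]; applyUpTo; _∷ʳ_)
open import Data.List.Properties using (applyUpTo-∷ʳ; map-upTo)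
open import Data.Nat
open import Data.Nat.Combinatorics
  using (_C_; nCk+nC[k+1]≡[n+1]C[k+1]; nCk≡nC[n∸k]; nCn≡1; nC1≡n; k>n⇒nCk≡0)
open import Data.Nat.ListAction using (sum)
open import Data.Nat.ListAction.Properties using (sum-++)
open import Data.Nat.Properties
open import Algebra.Properties.CommutativeSemigroup +-commutativeSemigroup
  using () renaming (interchange to +-interchange)
open import Data.Nat.Tactic.RingSolver using (solve-∀; solve)
open import Data.Product using (_,_)
open import Data.Sum using (inj₁; inj₂)
open import Data.Unit using (tt)
open import Function using (_∘_)
open import Relation.Binary.PropositionalEquality
  using (_≡_; refl; sym; trans; cong; cong₂; subst; module ≡-Reasoning)
open import Relation.Nullary.Decidable using (toWitness)

open import Defs

-- To prove L ≡ R from hypotheses lᵢ ≡ rᵢ, combine them into u ≡ v (each multiplied by a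
-- coefficient, signed via scale-≡); the remaining goal L + v ≡ R + u is a ring identity.
cancel-combination : ∀ {L R u v : ℕ} → u ≡ v → L + v ≡ R + u → L ≡ R
cancel-combination {L} {R} {u} refl L+u≡R+u = +-cancelʳ-≡ u L R L+u≡R+u

scale-≡ : ∀ p q {l r : ℕ} → l ≡ r → p * l + q * r ≡ p * r + q * l
scale-≡ p q refl = refl

≤-from-excess : ∀ k .{{_ : NonZero k}} e {x y} → k * x + e ≡ k * y → x ≤ y
≤-from-excess k e {x} kx+e≡ky = *-cancelˡ-≤ k (subst (k * x ≤_) kx+e≡ky (m≤m+n (k * x) e))

homogeneous-quadratic-< : ∀ L .{{_ : NonZero L}} {α β γ a b u v e} →
  0 < a → L * a ≡ u → L * b ≡ v → α * (v * v) + γ * (u * u) + u * u + e ≡ β * (u * v) →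
  α * (b * b) + γ * (a * a) < β * (a * b)
homogeneous-quadratic-< L {α} {β} {γ} {a} {b} {u} {v} {e} 0<a La≡u Lb≡v identity =
  *-cancelˡ-< (L * L) _ _ (begin-strict
    L * L * (α * (b * b) + γ * (a * a))            ≡⟨ scale-in L α γ a b ⟩
    α * (L * b * (L * b)) + γ * (L * a * (L * a))  ≡⟨ cong₂ (λ x y → α * (y * y) + γ * (x * x)) La≡u Lb≡v ⟩
    α * (v * v) + γ * (u * u)                      <⟨ m<m+n _ (*-mono-≤ 0<u 0<u) ⟩
    α * (v * v) + γ * (u * u) + u * u              ≤⟨ m≤m+n _ e ⟩
    α * (v * v) + γ * (u * u) + u * u + e          ≡⟨ identity ⟩
    β * (u * v)                                    ≡⟨ cong₂ (λ x y → β * (x * y)) La≡u Lb≡v ⟨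
    β * (L * a * (L * b))                          ≡⟨ scale-out L β a b ⟩
    L * L * (β * (a * b))                          ∎)
  where
  open ≤-Reasoning
  0<u : 0 < u
  0<u = subst (0 <_) La≡u (≤-trans 0<a (m≤n*m a L))
  scale-in : ∀ L α γ a b →
    L * L * (α * (b * b) + γ * (a * a)) ≡ α * (L * b * (L * b)) + γ * (L * a * (L * a))
  scale-in = solve-∀
  scale-out : ∀ L β a b → β * (L * a * (L * b)) ≡ L * L * (β * (a * b))
  scale-out = solve-∀

∑< : ℕ → (ℕ → ℕ) → ℕ
∑< N f = sum (applyUpTo f N)

syntax ∑< N (λ k → e) = ∑[ k < N ] e

∑-cong : ∀ N {f g : ℕ → ℕ} → (∀ k → f k ≡ g k) → ∑< N f ≡ ∑< N g
∑-cong zero    f≗g = refl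
∑-cong (suc N) f≗g = cong₂ _+_ (f≗g 0) (∑-cong N (f≗g ∘ suc))

∑-distrib-+ : ∀ N (f g : ℕ → ℕ) → ∑[ k < N ] (f k + g k) ≡ ∑< N f + ∑< N g
∑-distrib-+ zero    f g = refl
∑-distrib-+ (suc N) f g = begin
  f 0 + g 0 + ∑[ k < N ] (f (suc k) + g (suc k))
    ≡⟨ cong (f 0 + g 0 +_) (∑-distrib-+ N (f ∘ suc) (g ∘ suc)) ⟩
  f 0 + g 0 + (∑< N (f ∘ suc) + ∑< N (g ∘ suc))
    ≡⟨ +-interchange (f 0) (g 0) _ _ ⟩
  f 0 + ∑< N (f ∘ suc) + (g 0 + ∑< N (g ∘ suc))
    ∎
  where open ≡-Reasoning

*-distribˡ-∑ : ∀ N c (f : ℕ → ℕ) → ∑[ k < N ] (c * f k) ≡ c * ∑< N f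
*-distribˡ-∑ zero    c f = sym (*-zeroʳ c)
*-distribˡ-∑ (suc N) c f = begin
  c * f 0 + ∑[ k < N ] (c * f (suc k))  ≡⟨ cong (c * f 0 +_) (*-distribˡ-∑ N c (f ∘ suc)) ⟩
  c * f 0 + c * ∑< N (f ∘ suc)          ≡⟨ *-distribˡ-+ c (f 0) _ ⟨
  c * (f 0 + ∑< N (f ∘ suc))            ∎
  where open ≡-Reasoning

∑-linear : ∀ N a b (f g : ℕ → ℕ) → ∑[ k < N ] (a * f k + b * g k) ≡ a * ∑< N f + b * ∑< N g
∑-linear N a b f g = trans (∑-distrib-+ N _ _) (cong₂ _+_ (*-distribˡ-∑ N a f) (*-distribˡ-∑ N b g))

∑-last : ∀ N (f : ℕ → ℕ) → ∑< (suc N) f ≡ ∑< N f + f N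
∑-last N f = begin
  sum (applyUpTo f (suc N))      ≡⟨ cong sum (applyUpTo-∷ʳ f N) ⟨
  sum (applyUpTo f N ∷ʳ f N)     ≡⟨ sum-++ (applyUpTo f N) [ f N ] ⟩
  ∑< N f + (f N + 0)             ≡⟨ cong (∑< N f +_) (+-identityʳ (f N)) ⟩
  ∑< N f + f N                   ∎
  where open ≡-Reasoning

∑-vanishing-tail : ∀ {N M} (f : ℕ → ℕ) → (∀ {k} → N ≤ k → f k ≡ 0) → N ≤ M → ∑< M f ≡ ∑< N f
∑-vanishing-tail {M = zero}  f f≡0 z≤n = refl
∑-vanishing-tail {N} {suc M} f f≡0 N≤1+M with m≤n⇒m<n∨m≡n N≤1+M
... | inj₂ refl    = refl
... | inj₁ N<1+M = begin
  ∑< (suc M) f   ≡⟨ ∑-last M f ⟩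
  ∑< M f + f M   ≡⟨ cong₂ _+_ (∑-vanishing-tail f f≡0 N≤M) (f≡0 N≤M) ⟩
  ∑< N f + 0     ≡⟨ +-identityʳ _ ⟩
  ∑< N f         ∎
  where
  open ≡-Reasoning
  N≤M = m<1+n⇒m≤n N<1+M

∑-telescope : ∀ N {P Q g h : ℕ → ℕ} →
              (∀ k → P k + g k + h (suc k) ≡ Q k + g (suc k) + h k) →
              ∑< N P + g 0 + h N ≡ ∑< N Q + g N + h 0
∑-telescope zero    step = refl
∑-telescope (suc N) {P} {Q} {g} {h} step =
  cancel-combination (cong₂ _+_ (step 0) (∑-telescope N (step ∘ suc)))
    (shuffle (P 0) (Q 0) (g 0) (g 1) (g (suc N)) (h 0) (h 1) (h (suc N))
             (∑< N (P ∘ suc)) (∑< N (Q ∘ suc)))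
  where
  shuffle : ∀ p q g₀ g₁ gₙ h₀ h₁ hₙ sp sq →
    p + sp + g₀ + hₙ + (q + g₁ + h₀ + (sq + gₙ + h₁))
      ≡ q + sq + gₙ + h₀ + (p + g₀ + h₁ + (sp + g₁ + hₙ))
  shuffle = solve-∀

∑-telescope-vanishing : ∀ N {P Q g h : ℕ → ℕ} →
  (∀ k → P k + g k + h (suc k) ≡ Q k + g (suc k) + h k) →
  g 0 ≡ 0 → g N ≡ 0 → h 0 ≡ 0 → h N ≡ 0 → ∑< N P ≡ ∑< N Q
∑-telescope-vanishing N {P} {Q} {g} {h} step g₀≡0 gₙ≡0 h₀≡0 hₙ≡0 = begin
  ∑< N P                  ≡⟨ +-0 (∑< N P) ⟨
  ∑< N P + 0 + 0          ≡⟨ cong₂ (λ a b → ∑< N P + a + b) g₀≡0 hₙ≡0 ⟨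
  ∑< N P + g 0 + h N      ≡⟨ ∑-telescope N step ⟩
  ∑< N Q + g N + h 0      ≡⟨ cong₂ (λ a b → ∑< N Q + a + b) gₙ≡0 h₀≡0 ⟩
  ∑< N Q + 0 + 0          ≡⟨ +-0 (∑< N Q) ⟩
  ∑< N Q                  ∎
  where
  open ≡-Reasoning
  +-0 : ∀ m → m + 0 + 0 ≡ m
  +-0 m = trans (+-identityʳ (m + 0)) (+-identityʳ m)

nC0≡1 : ∀ n → n C 0 ≡ 1
nC0≡1 n = trans (nCk≡nC[n∸k] {0} {n} z≤n) (nCn≡1 n)

[1+k]*[1+n]C[1+k]≡[1+n]*nCk : ∀ n k → suc k * (suc n C suc k) ≡ suc n * (n C k)
[1+k]*[1+n]C[1+k]≡[1+n]*nCk zero    zero    = refl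
[1+k]*[1+n]C[1+k]≡[1+n]*nCk zero    (suc k) = *-zeroʳ (2 + k)
[1+k]*[1+n]C[1+k]≡[1+n]*nCk (suc n) zero    = begin
  1 * (suc (suc n) C 1)      ≡⟨ *-identityˡ _ ⟩
  suc (suc n) C 1            ≡⟨ nC1≡n (suc (suc n)) ⟩
  suc (suc n)                ≡⟨ *-identityʳ _ ⟨
  suc (suc n) * 1            ≡⟨ cong (suc (suc n) *_) (nC0≡1 (suc n)) ⟨
  suc (suc n) * (suc n C 0)  ∎
  where open ≡-Reasoning
[1+k]*[1+n]C[1+k]≡[1+n]*nCk (suc n) (suc k) = begin
  suc (suc k) * (suc (suc n) C suc (suc k))  ≡⟨ cong (suc (suc k) *_) (pascal (suc n) (suc k)) ⟨
  suc (suc k) * (x + y)                      ≡⟨ regroup k x y ⟩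
  x + (suc k * x + suc (suc k) * y)          ≡⟨ cong₂ (λ u v → x + (u + v)) (absorb n k) (absorb n (suc k)) ⟩
  x + (suc n * (n C k) + suc n * (n C suc k)) ≡⟨ cong (x +_) (*-distribˡ-+ (suc n) (n C k) (n C suc k)) ⟨
  x + suc n * (n C k + n C suc k)            ≡⟨ cong (λ u → x + suc n * u) (pascal n k) ⟩
  x + suc n * x                              ∎
  where
  open ≡-Reasoning
  pascal = nCk+nC[k+1]≡[n+1]C[k+1]
  absorb = [1+k]*[1+n]C[1+k]≡[1+n]*nCk
  x = suc n C suc k
  y = suc n C suc (suc k)
  regroup : ∀ k x y → suc (suc k) * (x + y) ≡ x + (suc k * x + suc (suc k) * y)
  regroup = solve-∀

[2k+1]Ck≡[2k+1]C[1+k] : ∀ k → suc (2 * k) C k ≡ suc (2 * k) C suc k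
[2k+1]Ck≡[2k+1]C[1+k] k = begin
  suc (2 * k) C k                  ≡⟨ nCk≡nC[n∸k] (m≤n⇒m≤1+n (m≤n*m k 2)) ⟩
  suc (2 * k) C (suc (2 * k) ∸ k)  ≡⟨ cong (λ m → suc (2 * k) C (m ∸ k)) (split k) ⟩
  suc (2 * k) C (k + suc k ∸ k)    ≡⟨ cong (suc (2 * k) C_) (m+n∸m≡n k (suc k)) ⟩
  suc (2 * k) C suc k              ∎
  where
  open ≡-Reasoning
  split : ∀ k → suc (2 * k) ≡ k + suc k
  split = solve-∀

[1+k]*[2+2k]C[1+k]≡2[2k+1]*[2k]Ck : ∀ k → suc k * (2 * suc k C suc k) ≡ 2 * (2 * k + 1) * (2 * k C k)
[1+k]*[2+2k]C[1+k]≡2[2k+1]*[2k]Ck k = begin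
  suc k * (2 * suc k C suc k)                ≡⟨ cong (λ m → suc k * (m C suc k)) (*-suc 2 k) ⟩
  suc k * (suc (suc (2 * k)) C suc k)        ≡⟨ [1+k]*[1+n]C[1+k]≡[1+n]*nCk (suc (2 * k)) k ⟩
  suc (suc (2 * k)) * (suc (2 * k) C k)      ≡⟨ cong (suc (suc (2 * k)) *_) ([2k+1]Ck≡[2k+1]C[1+k] k) ⟩
  suc (suc (2 * k)) * (suc (2 * k) C suc k)  ≡⟨ double k (suc (2 * k) C suc k) ⟩
  2 * (suc k * (suc (2 * k) C suc k))        ≡⟨ cong (2 *_) ([1+k]*[1+n]C[1+k]≡[1+n]*nCk (2 * k) k) ⟩
  2 * (suc (2 * k) * (2 * k C k))            ≡⟨ reassoc k (2 * k C k) ⟩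
  2 * (2 * k + 1) * (2 * k C k)              ∎
  where
  open ≡-Reasoning
  double : ∀ k x → suc (suc (2 * k)) * x ≡ 2 * (suc k * x)
  double = solve-∀
  reassoc : ∀ k x → 2 * (suc (2 * k) * x) ≡ 2 * (2 * k + 1) * x
  reassoc = solve-∀

t : ℕ → ℕ → ℕ
t n k = (n C k) * (n C k) * (2 * k C k)

F : ℕ → ℕ
F n = ∑< (suc n) (t n)

W : ℕ → ℕ
W n = ∑[ k < suc n ] (k * t n k)

tn0≡1 : ∀ n → t n 0 ≡ 1
tn0≡1 n = cong (λ c → c * c * 1) (nC0≡1 n)

t-vanishes : ∀ {n k} → n < k → t n k ≡ 0
t-vanishes {n} {k} n<k = cong (λ c → c * c * (2 * k C k)) (k>n⇒nCk≡0 n<k)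

∑t≡F : ∀ {n N} → n < N → ∑< N (t n) ≡ F n
∑t≡F = ∑-vanishing-tail _ t-vanishes

∑kt≡W : ∀ {n N} → n < N → ∑[ k < N ] (k * t n k) ≡ W n
∑kt≡W = ∑-vanishing-tail _ (λ {k} n<k → trans (cong (k *_) (t-vanishes n<k)) (*-zeroʳ k))

Gₘ : ℕ → ℕ → ℕ
Gₘ n zero    = 0
Gₘ n (suc j) = 2 * (2 * j + 1) * t n j

moment-summand-identity : ∀ n j x y X c d → y + x ≡ X →
  suc j * X ≡ suc n * y → suc j * c ≡ 2 * (2 * j + 1) * d →
  3 * (suc j * (x * x * c)) + 2 * suc n * (X * X * c) + 2 * (2 * j + 1) * (y * y * d)
    ≡ 2 * n * (x * x * c) + 3 * (suc j * (X * X * c)) + 2 * (2 * suc j + 1) * (x * x * c)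
moment-summand-identity n j x y _ c d refl e₁ e₃ =
  cancel-combination (cong₂ _+_ (cong ((4 * x + 2 * y) * c *_) (sym e₁)) (cong (y * y *_) (sym e₃)))
                     (solve (n ∷ j ∷ x ∷ y ∷ c ∷ d ∷ []))

moment-summand : ∀ n k →
  3 * (k * t n k) + 2 * suc n * t (suc n) k + Gₘ n k
    ≡ 2 * n * t n k + 3 * (k * t (suc n) k) + Gₘ n (suc k)
moment-summand n zero rewrite tn0≡1 n | tn0≡1 (suc n) = base n
  where
  base : ∀ n → 3 * (0 * 1) + 2 * suc n * 1 + 0 ≡ 2 * n * 1 + 3 * (0 * 1) + 2 * (2 * 0 + 1) * 1
  base = solve-∀
moment-summand n (suc j) =
  moment-summand-identity n j (n C suc j) (n C j) (suc n C suc j) (2 * suc j C suc j) (2 * j C j)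
    (nCk+nC[k+1]≡[n+1]C[k+1] n j) ([1+k]*[1+n]C[1+k]≡[1+n]*nCk n j)
    ([1+k]*[2+2k]C[1+k]≡2[2k+1]*[2k]Ck j)

moment-recurrence : ∀ n → 3 * W n + 2 * suc n * F (suc n) ≡ 2 * n * F n + 3 * W (suc n)
moment-recurrence n = begin
  3 * W n + 2 * suc n * F (suc n)
    ≡⟨ cong (λ w → 3 * w + 2 * suc n * F (suc n)) (∑kt≡W n<N) ⟨
  3 * ∑[ k < N ] (k * t n k) + 2 * suc n * F (suc n)
    ≡⟨ ∑-linear N 3 (2 * suc n) (λ k → k * t n k) (t (suc n)) ⟨
  ∑[ k < N ] (3 * (k * t n k) + 2 * suc n * t (suc n) k)
    ≡⟨ ∑-telescope-vanishing N {g = Gₘ n} {h = λ _ → 0}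
         (λ k → cong (_+ 0) (moment-summand n k)) refl Gₘ-end refl refl ⟩
  ∑[ k < N ] (2 * n * t n k + 3 * (k * t (suc n) k))
    ≡⟨ ∑-linear N (2 * n) 3 (t n) (λ k → k * t (suc n) k) ⟩
  2 * n * ∑< N (t n) + 3 * W (suc n)
    ≡⟨ cong (λ f → 2 * n * f + 3 * W (suc n)) (∑t≡F n<N) ⟩
  2 * n * F n + 3 * W (suc n)
    ∎
  where
  open ≡-Reasoning
  N = suc (suc n)
  n<N : n < N
  n<N = m<n⇒m<1+n (n<1+n n)
  Gₘ-end : Gₘ n N ≡ 0
  Gₘ-end = trans (cong (2 * (2 * suc n + 1) *_) (t-vanishes (n<1+n n))) (*-zeroʳ (2 * (2 * suc n + 1)))

3W≡2nF : ∀ n → 3 * W n ≡ 2 * n * F n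
3W≡2nF zero    = refl
3W≡2nF (suc n) = +-cancelˡ-≡ (2 * n * F n) _ _ (begin
  2 * n * F n + 3 * W (suc n)          ≡⟨ moment-recurrence n ⟨
  3 * W n + 2 * suc n * F (suc n)      ≡⟨ cong (_+ 2 * suc n * F (suc n)) (3W≡2nF n) ⟩
  2 * n * F n + 2 * suc n * F (suc n)  ∎)
  where open ≡-Reasoning

S≡2W+F : ∀ n → S n ≡ 2 * W n + F n
S≡2W+F n = begin
  S n                                           ≡⟨ cong sum (map-upTo (term n) (suc n)) ⟩
  ∑< (suc n) (term n)                           ≡⟨ ∑-cong (suc n) (λ k → split (n C k) (2 * k C k) k) ⟩
  ∑[ k < suc n ] (2 * (k * t n k) + 1 * t n k)  ≡⟨ ∑-linear (suc n) 2 1 (λ k → k * t n k) (t n) ⟩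
  2 * W n + 1 * F n                             ≡⟨ cong (2 * W n +_) (*-identityˡ (F n)) ⟩
  2 * W n + F n                                 ∎
  where
  open ≡-Reasoning
  split : ∀ a c k → a * (a * 1) * c * (2 * k + 1) ≡ 2 * (k * (a * a * c)) + 1 * (a * a * c)
  split = solve-∀

3S≡[4n+3]F : ∀ n → 3 * S n ≡ (4 * n + 3) * F n
3S≡[4n+3]F n = begin
  3 * S n                    ≡⟨ cong (3 *_) (S≡2W+F n) ⟩
  3 * (2 * W n + F n)        ≡⟨ regroup (W n) (F n) ⟩
  2 * (3 * W n) + 3 * F n    ≡⟨ cong (λ w → 2 * w + 3 * F n) (3W≡2nF n) ⟩
  2 * (2 * n * F n) + 3 * F n ≡⟨ collect n (F n) ⟩
  (4 * n + 3) * F n          ∎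
  where
  open ≡-Reasoning
  regroup : ∀ w f → 3 * (2 * w + f) ≡ 2 * (3 * w) + 3 * f
  regroup = solve-∀
  collect : ∀ n f → 2 * (2 * n * f) + 3 * f ≡ (4 * n + 3) * f
  collect = solve-∀

-- The certificate G⁺ − G⁻ of the recurrence can be negative, so it is kept as two ℕ-valued parts.
G⁺ G⁻ : ℕ → ℕ → ℕ
G⁺ n zero    = 0
G⁺ n (suc j) = t (suc n) j * (10 + 14 * j + 8 * n + 16 * n * j)
G⁻ n zero    = 0
G⁻ n (suc j) = t (suc n) j * (12 * (j * j))

recurrence-summand-identity : ∀ n j x y z X Y c d → y + x ≡ X → z + X ≡ Y →
  suc j * X ≡ suc n * y → suc j * Y ≡ suc (suc n) * z → suc j * c ≡ 2 * (2 * j + 1) * d →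
  (10 * n * n + 30 * n + 23) * (X * X * c) + z * z * d * (10 + 14 * j + 8 * n + 16 * n * j)
      + X * X * c * (12 * (suc j * suc j))
    ≡ 9 * (suc n * suc n) * (x * x * c) + (2 + n) * (2 + n) * (Y * Y * c)
      + X * X * c * (10 + 14 * suc j + 8 * n + 16 * n * suc j) + z * z * d * (12 * (j * j))
recurrence-summand-identity n j x y z _ _ c d refl refl e₁ e₂ e₃ =
  cancel-combination
    (cong₂ _+_ (cong₂ _+_
      (scale-≡ (c * (12 * j * (x + y) + 3 * y) + 6 * (2 * j + 1) * d * z)
               (c * (18 * n * x + 9 * n * y + 3 * n * z + 6 * x + 6 * z)) e₁)
      (scale-≡ (c * (2 * n * x + 5 * n * y + n * z + 4 * x + 7 * y + 2 * z))
               (6 * (2 * j + 1) * d * z) e₂))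
      (cong (z * (3 * n * y + n * z + 3 * y + 2 * z) *_) (sym e₃)))
    (solve (n ∷ j ∷ x ∷ y ∷ z ∷ c ∷ d ∷ []))

recurrence-summand : ∀ n k →
  (10 * n * n + 30 * n + 23) * t (suc n) k + G⁺ n k + G⁻ n (suc k)
    ≡ 9 * (suc n * suc n) * t n k + (2 + n) * (2 + n) * t (2 + n) k + G⁺ n (suc k) + G⁻ n k
recurrence-summand n zero rewrite tn0≡1 n | tn0≡1 (suc n) | tn0≡1 (2 + n) = base n
  where
  base : ∀ n →
    (10 * n * n + 30 * n + 23) * 1 + 0 + 1 * (12 * (0 * 0))
      ≡ 9 * (suc n * suc n) * 1 + (2 + n) * (2 + n) * 1 + 1 * (10 + 14 * 0 + 8 * n + 16 * n * 0) + 0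
  base = solve-∀
recurrence-summand n (suc j) =
  recurrence-summand-identity n j (n C suc j) (n C j) (suc n C j) (suc n C suc j) ((2 + n) C suc j)
    (2 * suc j C suc j) (2 * j C j)
    (nCk+nC[k+1]≡[n+1]C[k+1] n j) (nCk+nC[k+1]≡[n+1]C[k+1] (suc n) j)
    ([1+k]*[1+n]C[1+k]≡[1+n]*nCk n j) ([1+k]*[1+n]C[1+k]≡[1+n]*nCk (suc n) j)
    ([1+k]*[2+2k]C[1+k]≡2[2k+1]*[2k]Ck j)

F-recurrence : ∀ n →
  9 * (suc n * suc n) * F n + (2 + n) * (2 + n) * F (2 + n) ≡ (10 * n * n + 30 * n + 23) * F (suc n)
F-recurrence n = begin
  9 * (suc n * suc n) * F n + (2 + n) * (2 + n) * F (2 + n)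
    ≡⟨ cong₂ (λ f f′ → 9 * (suc n * suc n) * f + (2 + n) * (2 + n) * f′)
             (∑t≡F n<N) (∑t≡F (n<1+n (2 + n))) ⟨
  9 * (suc n * suc n) * ∑< N (t n) + (2 + n) * (2 + n) * ∑< N (t (2 + n))
    ≡⟨ ∑-linear N (9 * (suc n * suc n)) ((2 + n) * (2 + n)) (t n) (t (2 + n)) ⟨
  ∑[ k < N ] (9 * (suc n * suc n) * t n k + (2 + n) * (2 + n) * t (2 + n) k)
    ≡⟨ ∑-telescope-vanishing N {g = G⁺ n} {h = G⁻ n}
         (recurrence-summand n) refl G⁺-end refl G⁻-end ⟨
  ∑[ k < N ] ((10 * n * n + 30 * n + 23) * t (suc n) k)
    ≡⟨ *-distribˡ-∑ N (10 * n * n + 30 * n + 23) (t (suc n)) ⟩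
  (10 * n * n + 30 * n + 23) * ∑< N (t (suc n))
    ≡⟨ cong ((10 * n * n + 30 * n + 23) *_) (∑t≡F (m<n⇒m<1+n (n<1+n (suc n)))) ⟩
  (10 * n * n + 30 * n + 23) * F (suc n)
    ∎
  where
  open ≡-Reasoning
  N = 3 + n
  n<N : n < N
  n<N = m<n⇒m<1+n (m<n⇒m<1+n (n<1+n n))
  t-end : t (suc n) (2 + n) ≡ 0
  t-end = t-vanishes (n<1+n (suc n))
  G⁺-end : G⁺ n N ≡ 0
  G⁺-end = cong (_* (10 + 14 * (2 + n) + 8 * n + 16 * n * (2 + n))) t-end
  G⁻-end : G⁻ n N ≡ 0
  G⁻-end = cong (_* (12 * ((2 + n) * (2 + n)))) t-end

lower-ratio-step : ∀ n a b c →
  9 * (suc n * suc n) * a + (2 + n) * (2 + n) * c ≡ (10 * n * n + 30 * n + 23) * b →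
  3 * a ≤ b → 3 * b ≤ c
lower-ratio-step n a b c rec 3a≤b with m≤n⇒∃[o]m+o≡n 3a≤b
... | p , 3a+p≡b =
  ≤-from-excess ((2 + n) * (2 + n)) (4 * (suc n * (2 + n)) * b + 3 * (suc n * suc n) * p)
  (cancel-combination (cong₂ _+_ (sym rec) (cong (3 * (suc n * suc n) *_) 3a+p≡b))
                      (solve (n ∷ a ∷ b ∷ c ∷ p ∷ [])))

upper-ratio-step : ∀ n a b c →
  9 * (suc n * suc n) * a + (2 + n) * (2 + n) * c ≡ (10 * n * n + 30 * n + 23) * b →
  (4 * n + 5) * b ≤ 9 * (4 * n + 1) * a → (4 * suc n + 5) * c ≤ 9 * (4 * suc n + 1) * b
upper-ratio-step n a b c rec ub with m≤n⇒∃[o]m+o≡n ub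
... | q , kb+q≡Ma =
  ≤-from-excess ((1 + 4 * n) * ((2 + n) * (2 + n))) ((4 * n + 9) * (suc n * suc n) * q + 18 * b)
  (cancel-combination (cong₂ _+_ (cong ((4 * n + 1) * (4 * n + 9) *_) rec)
                                 (cong ((suc n * suc n) * (4 * n + 9) *_) kb+q≡Ma))
                      (solve (n ∷ a ∷ b ∷ c ∷ q ∷ [])))

F-lower-ratio : ∀ n → 3 * F n ≤ F (suc n)
F-lower-ratio zero    = ≤-refl
F-lower-ratio (suc n) = lower-ratio-step n (F n) (F (suc n)) (F (2 + n)) (F-recurrence n) (F-lower-ratio n)

F-upper-ratio : ∀ n → (4 * suc n + 5) * F (2 + n) ≤ 9 * (4 * suc n + 1) * F (suc n)
F-upper-ratio zero    = ≤-refl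
F-upper-ratio (suc n) =
  upper-ratio-step (suc n) (F (suc n)) (F (2 + n)) (F (3 + n)) (F-recurrence (suc n)) (F-upper-ratio n)

F-pos : ∀ n → 0 < F n
F-pos n = ≤-trans (≤-reflexive (sym (tn0≡1 n))) (m≤m+n (t n 0) (∑< n (t n ∘ suc)))

-- In log-convex-step, u = (4n+5) p + q and v = 9(4n+1) p + 3 q are L·F n and L·F(n+1), where
-- n = 1 + m and L = 18 + 24m; the last two summands on the left are the margin u² and a form in
-- p, q with nonnegative coefficients.
quadratic-form-identity : ∀ m p q →
  (2 + suc m) * (2 + suc m) * ((4 * suc (suc m) + 3) * (4 * suc (suc m) + 3))
      * ((9 * (4 * suc m + 1) * p + 3 * q) * (9 * (4 * suc m + 1) * p + 3 * q))
    + 9 * (suc (suc m) * suc (suc m)) * ((4 * suc m + 3) * (4 * (2 + suc m) + 3))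
      * (((4 * suc m + 5) * p + q) * ((4 * suc m + 5) * p + q))
    + ((4 * suc m + 5) * p + q) * ((4 * suc m + 5) * p + q)
    + ((20736 * m * m * m + 132176 * m * m + 268200 * m + 167589) * (p * p)
      + (3072 * m * m * m * m * m + 34560 * m * m * m * m + 147840 * m * m * m + 301104 * m * m
         + 294292 * m + 114192) * (p * q)
      + (192 * m * m * m * m + 2016 * m * m * m + 7548 * m * m + 11772 * m + 6263) * (q * q))
  ≡ (4 * suc m + 3) * (4 * (2 + suc m) + 3) * (10 * suc m * suc m + 30 * suc m + 23)
      * (((4 * suc m + 5) * p + q) * (9 * (4 * suc m + 1) * p + 3 * q))
quadratic-form-identity = solve-∀

log-convex-step : ∀ m a b c p q →
  9 * (suc (suc m) * suc (suc m)) * a + (2 + suc m) * (2 + suc m) * c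
    ≡ (10 * suc m * suc m + 30 * suc m + 23) * b →
  0 < a → 3 * a + p ≡ b → (4 * suc m + 5) * b + q ≡ 9 * (4 * suc m + 1) * a →
  (4 * suc (suc m) + 3) * b * ((4 * suc (suc m) + 3) * b) < (4 * (2 + suc m) + 3) * c * ((4 * suc m + 3) * a)
log-convex-step m a b c p q rec 0<a 3a+p≡b kb+q≡Ma =
  *-cancelˡ-< Q _ _ (+-cancelʳ-< (γ * (a * a)) _ _ (begin-strict
    Q * (x′ * b * (x′ * b)) + γ * (a * a)  ≡⟨ cong (_+ γ * (a * a)) (regroup Q x′ b) ⟩
    α * (b * b) + γ * (a * a)              <⟨ homogeneous-quadratic-< (18 + 24 * m) {α} {β} {γ}
                                                 0<a La≡u Lb≡v (quadratic-form-identity m p q) ⟩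
    β * (a * b)                            ≡⟨ eliminate P Q A x y a b c rec ⟩
    Q * (y * c * (x * a)) + γ * (a * a)    ∎))
  where
  open ≤-Reasoning
  n = suc m
  x = 4 * n + 3
  x′ = 4 * suc n + 3
  y = 4 * (2 + n) + 3
  P = 9 * (suc n * suc n)
  Q = (2 + n) * (2 + n)
  α = Q * (x′ * x′)
  A = 10 * n * n + 30 * n + 23
  β = x * y * A
  γ = P * (x * y)
  regroup : ∀ Q x b → Q * (x * b * (x * b)) ≡ Q * (x * x) * (b * b)
  regroup = solve-∀
  eliminate : ∀ P Q A x y a b c → P * a + Q * c ≡ A * b →
              x * y * A * (a * b) ≡ Q * (y * c * (x * a)) + P * (x * y) * (a * a)
  eliminate P Q A x y a b c Pa+Qc≡Ab =
    cancel-combination (cong (x * y * a *_) (sym Pa+Qc≡Ab))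
                       (solve (P ∷ Q ∷ A ∷ x ∷ y ∷ a ∷ b ∷ c ∷ []))
  La≡u : (18 + 24 * m) * a ≡ (4 * suc m + 5) * p + q
  La≡u = cancel-combination (cong₂ _+_ (cong ((4 * suc m + 5) *_) (sym 3a+p≡b)) (sym kb+q≡Ma))
                            (solve (m ∷ a ∷ b ∷ p ∷ q ∷ []))
  Lb≡v : (18 + 24 * m) * b ≡ 9 * (4 * suc m + 1) * p + 3 * q
  Lb≡v = cancel-combination (cong₂ _+_ (cong (9 * (4 * suc m + 1) *_) (sym 3a+p≡b))
                                       (cong (3 *_) (sym kb+q≡Ma)))
                            (solve (m ∷ a ∷ b ∷ p ∷ q ∷ []))

F-log-convex : ∀ n →
  (4 * suc n + 3) * F (suc n) * ((4 * suc n + 3) * F (suc n))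
    < (4 * (2 + n) + 3) * F (2 + n) * ((4 * n + 3) * F n)
F-log-convex zero    = toWitness {a? = _ <? _} tt
F-log-convex (suc m) =
  log-convex-step m (F (suc m)) (F (2 + m)) (F (3 + m)) _ _ (F-recurrence (suc m)) (F-pos (suc m))
    (m+[n∸m]≡n (F-lower-ratio (suc m))) (m+[n∸m]≡n (F-upper-ratio m))

theorem4p1 : ∀ (n : ℕ) → S (suc n) ^ 2 < S (suc (suc n)) * S n
theorem4p1 n = *-cancelˡ-< 9 _ _ (begin-strict
  9 * S (suc n) ^ 2
    ≡⟨ square-scale (S (suc n)) ⟩
  3 * S (suc n) * (3 * S (suc n))
    ≡⟨ cong₂ _*_ (3S≡[4n+3]F (suc n)) (3S≡[4n+3]F (suc n)) ⟩
  (4 * suc n + 3) * F (suc n) * ((4 * suc n + 3) * F (suc n))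
    <⟨ F-log-convex n ⟩
  (4 * (2 + n) + 3) * F (2 + n) * ((4 * n + 3) * F n)
    ≡⟨ cong₂ _*_ (3S≡[4n+3]F (2 + n)) (3S≡[4n+3]F n) ⟨
  3 * S (2 + n) * (3 * S n)
    ≡⟨ product-scale (S (2 + n)) (S n) ⟩
  9 * (S (2 + n) * S n)
    ∎)
  where
  open ≤-Reasoning
  square-scale : ∀ s → 9 * (s * (s * 1)) ≡ 3 * s * (3 * s)
  square-scale = solve-∀
  product-scale : ∀ s s′ → 3 * s * (3 * s′) ≡ 9 * (s * s′)
  product-scale = solve-∀
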